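{- Let $T$ be a tree with nonnegative edge lengths, and let a set of service requests be given, each located at a node of $T$ with a time window of unit length $[a,a+1]$, where no $a$ is an integer (perturbing by a negligible amount if necessary). Assume a single vehicle traveling at a fixed speed can service all requests within their time windows. Algorithm SINGLE-REPAIR: divide time into periods $[j, j+1)$, $j=0,1,2,\dots$; each window meets exactly two consecutive periods $[j,j+1)$ and $[j+1,j+2)$, and is expanded to $[j, j+2)$; put the request in set $\mathcal{E}$ if $j$ is even and in $\mathcal{O}$ if $j$ is odd. Compute a service run $R_{\mathcal{E}}$ that services the maximum possible number of requests of $\mathcal{E}$ with respect to the expanded windows, and similarly $R_{\mathcal{O}}$ for $\mathcal{O}$. Output $R_{\mathcal{E}}$, $R_{\mathcal{O}}$, and, for each of these two runs, a copy shifted 1 time unit earlier and a copy shifted 1 time unit later. Then the at most 6 output runs together service every request within its original (unexpanded) time window; that is, SINGLE-REPAIR is a 6-approximation to the Minimum Vehicle $OPT=1$ Problem on trees.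
   Context: A service run is a route of a single vehicle moving at a fixed speed along the tree (which may start at any node at any time and stop anywhere); it services a request if it is at the request's node at some time within the request's time window. The Minimum Vehicle $OPT=1$ Problem: given such requests on a graph under the promise that one vehicle can service all of them within their windows, find as few service runs as possible that together service all requests within their windows.
   Formalization: The edge lengths of T, the window starts $a$ and all times at which service runs visit nodes are rational. -}

module Defs where

open import Data.Nat using (ℕ; suc; _≤_)
import Data.Nat
open import Data.Fin using (Fin; toℕ; suc)
import Data.Fin as F
open import Data.Integer using (ℤ; +_)
import Data.Integer as ℤ
open import Data.Integer.Divisibility.Signed using (_∣_; _∣?_)
open import Data.Rational using (ℚ; 0ℚ; 1ℚ; _+_; _-_; _/_; floor)
import Data.Rational as ℚ
import Data.Rational.Properties as ℚ
open import Data.List using (List; []; _∷_; length; filter; allFin)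
open import Data.List.Relation.Unary.Any using (Any; any?)
open import Data.Product using (Σ; ∃; _×_; _,_; proj₁; proj₂)
open import Data.Sum using (_⊎_)
open import Relation.Nullary using (¬_; Dec; ¬?)
open import Relation.Nullary.Decidable using (_×-dec_)
open import Relation.Binary.PropositionalEquality using (_≡_)

-- Node (suc i) is joined by edge i to its parent (parent i), which has a
-- smaller index; every finite tree can be numbered this way (e.g. BFS order).
-- Edge lengths are measured in time units (vehicle speed normalised to 1).
record Tree : Set where
  field
    n        : ℕ
    parent   : Fin n → Fin (suc n)
    parent<  : (i : Fin n) → toℕ (parent i) ≤ toℕ i
    len      : Fin n → ℚ
    len≥0    : (i : Fin n) → 0ℚ ℚ.≤ len i

Node : Tree → Set
Node T = Fin (suc (Tree.n T))

EdgeBetween : (T : Tree) → Fin (Tree.n T) → Node T → Node T → Set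
EdgeBetween T i u v =
  (u ≡ suc i × v ≡ Tree.parent T i) ⊎ (v ≡ suc i × u ≡ Tree.parent T i)

Stop : Tree → Set
Stop T = Node T × ℚ

Step : (T : Tree) → Stop T → Stop T → Set
Step T (u , t) (v , t') =
  (u ≡ v × t ℚ.≤ t')
  ⊎ (Σ (Fin (Tree.n T)) λ i → EdgeBetween T i u v × (t + Tree.len T i) ℚ.≤ t')

-- A service run: a finite sequence of stops (starting at any node at any
-- time and stopping anywhere), consecutive stops joined by feasible steps.
Run : Tree → Set
Run T = List (Stop T)

data ValidRun (T : Tree) : Run T → Set where
  []  : ValidRun T []
  [_] : (s : Stop T) → ValidRun T (s ∷ [])
  _∷_ : ∀ {s s' rest} → Step T s s' → ValidRun T (s' ∷ rest) →
        ValidRun T (s ∷ s' ∷ rest)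

-- A request: a node together with the left end a of its unit window [a, a+1].
Request : Tree → Set
Request T = Node T × ℚ

VisitsIn : (T : Tree) → Run T → Node T → ℚ → ℚ → Set
VisitsIn T R v lo hi = Any (λ s → proj₁ s ≡ v ×
                                   lo ℚ.≤ proj₂ s ×
                                   proj₂ s ℚ.≤ hi) R

VisitsInHO : (T : Tree) → Run T → Node T → ℚ → ℚ → Set
VisitsInHO T R v lo hi = Any (λ s → proj₁ s ≡ v ×
                                     lo ℚ.≤ proj₂ s ×
                                     proj₂ s ℚ.< hi) R

Services : (T : Tree) → Run T → Request T → Set
Services T R (v , a) = VisitsIn T R v a (a + 1ℚ)

-- The period index j = ⌊a⌋ of a request; the window [a,a+1] meets periods
-- [j,j+1) and [j+1,j+2) and its expanded window is [j, j+2).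
period : ℚ → ℤ
period a = floor a

expLo : ℚ → ℚ
expLo a = period a / 1

expHi : ℚ → ℚ
expHi a = (period a ℤ.+ + 2) / 1

ServicesExpanded : (T : Tree) → Run T → Request T → Set
ServicesExpanded T R (v , a) = VisitsInHO T R v (expLo a) (expHi a)

InE : ℚ → Set
InE a = + 2 ∣ period a

InO : ℚ → Set
InO a = ¬ (+ 2 ∣ period a)

servicesExpanded? : (T : Tree) (R : Run T) (r : Request T) → Dec (ServicesExpanded T R r)
servicesExpanded? T R (v , a) =
  any? (λ s → (proj₁ s F.≟ v) ×-dec ((expLo a ℚ.≤? proj₂ s) ×-dec (proj₂ s ℚ.<? expHi a))) R

inE? : (a : ℚ) → Dec (InE a)
inE? a = + 2 ∣? period a

inO? : (a : ℚ) → Dec (InO a)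
inO? a = ¬? (inE? a)

countExpanded : (T : Tree) {m : ℕ} (reqs : Fin m → Request T)
                {C : ℚ → Set} (C? : (a : ℚ) → Dec (C a)) → Run T → ℕ
countExpanded T reqs C? R =
  length (filter (λ i → C? (proj₂ (reqs i)) ×-dec servicesExpanded? T R (reqs i)) (allFin _))

MaxExpanded : (T : Tree) {m : ℕ} (reqs : Fin m → Request T)
              {C : ℚ → Set} (C? : (a : ℚ) → Dec (C a)) → Run T → Set
MaxExpanded T reqs C? R =
  ValidRun T R × ((R' : Run T) → ValidRun T R' →
                  countExpanded T reqs C? R' Data.Nat.≤ countExpanded T reqs C? R)

shift : (T : Tree) → ℚ → Run T → Run T
shift T d [] = []
shift T d ((v , t) ∷ R) = (v , t + d) ∷ shift T d R

-- The optimal run services every request within its window, hence within the expanded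
-- window [⌊a⌋, ⌊a⌋ + 2), so it services every request of 𝓔 (and of 𝓞) in the expanded sense.
-- A run servicing the maximum number of them must therefore service all of them too.
-- Finally, a visit at time t ∈ [⌊a⌋, ⌊a⌋ + 2) lies in [a, a + 1], or t + 1 does (if t < a),
-- or t − 1 does (if t > a + 1): the run itself or one of its copies shifted by one time unit
-- services the request within its original window.
module Submission where

open import Defs
open import Algebra.Bundles using (CommutativeMonoid)
open import Algebra.Properties.Group using (//-rightDividesʳ)
import Algebra.Properties.CommutativeSemigroup as CommutativeSemigroup
open import Data.Fin using (Fin)
open import Data.Integer as ℤ using (ℤ; +_; 1ℤ)
import Data.Integer.Properties as ℤ
open import Data.Integer.DivMod using ([n/d]*d≤n; n<s[n/ℕd]*d; div-pos-is-/ℕ)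
open import Data.Integer.Solver using (module +-*-Solver)
open import Data.List using (List; []; _∷_; _++_; length; filter)
open import Data.List.Membership.Propositional using (_∈_)
open import Data.List.Membership.Propositional.Properties using (∈-allFin; ∈-filter⁺; ∈-filter⁻)
open import Data.List.Relation.Binary.Pointwise using (Pointwise-≡⇒≡)
open import Data.List.Relation.Binary.Sublist.Propositional.Properties
  using (filter⁺; length-mono-≤; to-≋)
open import Data.List.Relation.Binary.Sublist.Propositional using (_⊆_; ⊆-refl)
open import Data.List.Relation.Unary.All as All using (All)
import Data.List.Relation.Unary.All.Properties as All
open import Data.List.Relation.Unary.Any as Any using (Any; here; there)
open import Data.List.Relation.Unary.Any.Properties using (Any-⊎⁻; ++⁺ˡ; ++⁺ʳ)
open import Data.Nat as ℕ using (ℕ)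
import Data.Nat.Properties as ℕ
open import Data.Product using (Σ; _×_; _,_; proj₁; proj₂; map₂)
open import Data.Rational using (ℚ; mkℚ; 0ℚ; 1ℚ; _/_; _+_; _-_; -_; _≤_; _<_; floor; toℚᵘ)
open import Data.Rational.Properties
  using ( toℚᵘ-fromℚᵘ; toℚᵘ-injective; toℚᵘ-homo-+; toℚᵘ-cancel-≤; toℚᵘ-cancel-<
        ; +-0-group; +-0-commutativeMonoid
        ; ≤-trans; ≤-<-trans; <⇒≤; ≮⇒≥; _<?_; +-monoˡ-≤; +-monoˡ-<; module ≤-Reasoning )
open import Data.Rational.Unnormalised as ℚᵘ using (mkℚᵘ; *≤*; *<*; *≡*) renaming (_≃_ to _≃ᵘ_)
import Data.Rational.Unnormalised.Properties as ℚᵘ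
open import Data.Sum using (_⊎_; inj₁; inj₂)
import Data.Sum as Sum
open import Relation.Nullary using (Dec; yes; no)
open import Relation.Nullary.Decidable using (_×-dec_)
open import Relation.Unary using (Decidable)
open import Relation.Binary.PropositionalEquality using (_≡_; _≢_; refl; sym; cong; subst; module ≡-Reasoning)

toℚᵘ-/1 : ∀ z → toℚᵘ (z / 1) ≃ᵘ mkℚᵘ z 0
toℚᵘ-/1 z = toℚᵘ-fromℚᵘ (mkℚᵘ z 0)

/1-homo-+ : ∀ i j → (i ℤ.+ j) / 1 ≡ i / 1 + j / 1
/1-homo-+ i j = toℚᵘ-injective (begin
  toℚᵘ ((i ℤ.+ j) / 1)            ≈⟨ toℚᵘ-/1 (i ℤ.+ j) ⟩
  mkℚᵘ (i ℤ.+ j) 0                ≈⟨ *≡* (solve 2 (λ x y → (x :+ y) :* (con (+ 1) :* con (+ 1))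
                                                        := (x :* con (+ 1) :+ y :* con (+ 1)) :* con (+ 1))
                                                  refl i j) ⟩
  mkℚᵘ i 0 ℚᵘ.+ mkℚᵘ j 0          ≈⟨ ℚᵘ.+-cong (toℚᵘ-/1 i) (toℚᵘ-/1 j) ⟨
  toℚᵘ (i / 1) ℚᵘ.+ toℚᵘ (j / 1)  ≈⟨ toℚᵘ-homo-+ (i / 1) (j / 1) ⟨
  toℚᵘ (i / 1 + j / 1)            ∎)
  where open ℚᵘ.≃-Reasoning; open +-*-Solver

floor-≤ : ∀ p → floor p / 1 ≤ p
floor-≤ p@(mkℚ n d _) = toℚᵘ-cancel-≤ (ℚᵘ.≤-respˡ-≃ (ℚᵘ.≃-sym (toℚᵘ-/1 (floor p))) (*≤* qD≤n))
  where
  D = ℕ.suc d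
  qD≤n : n ℤ./ + D ℤ.* + D ℤ.≤ n ℤ.* + 1
  qD≤n = begin
    n ℤ./ + D ℤ.* + D  ≤⟨ [n/d]*d≤n n (+ D) ⟩
    n                  ≡⟨ ℤ.*-identityʳ n ⟨
    n ℤ.* + 1          ∎
    where open ℤ.≤-Reasoning

<-floor+1 : ∀ p → p < floor p / 1 + 1ℚ
<-floor+1 p@(mkℚ n d _) = subst (p <_) (/1-homo-+ (floor p) 1ℤ)
  (toℚᵘ-cancel-< (ℚᵘ.<-respʳ-≃ (ℚᵘ.≃-sym (toℚᵘ-/1 (floor p ℤ.+ 1ℤ))) (*<* n<[q+1]D)))
  where
  D = ℕ.suc d
  n<[q+1]D : n ℤ.* + 1 ℤ.< (n ℤ./ + D ℤ.+ 1ℤ) ℤ.* + D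
  n<[q+1]D = begin-strict
    n ℤ.* + 1                   ≡⟨ ℤ.*-identityʳ n ⟩
    n                           <⟨ n<s[n/ℕd]*d n D ⟩
    (1ℤ ℤ.+ n ℤ./ℕ D) ℤ.* + D   ≡⟨ cong (ℤ._* + D) (ℤ.+-comm 1ℤ (n ℤ./ℕ D)) ⟩
    (n ℤ./ℕ D ℤ.+ 1ℤ) ℤ.* + D   ≡⟨ cong (λ q → (q ℤ.+ 1ℤ) ℤ.* + D) (div-pos-is-/ℕ n D) ⟨
    (n ℤ./ + D ℤ.+ 1ℤ) ℤ.* + D  ∎
    where open ℤ.≤-Reasoning

expHi≡expLo+2 : ∀ a → expHi a ≡ expLo a + 1ℚ + 1ℚ
expHi≡expLo+2 a = begin
  (floor a ℤ.+ + 2) / 1           ≡⟨ cong (_/ 1) (ℤ.+-assoc (floor a) 1ℤ 1ℤ) ⟨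
  (floor a ℤ.+ 1ℤ ℤ.+ 1ℤ) / 1     ≡⟨ /1-homo-+ (floor a ℤ.+ 1ℤ) 1ℤ ⟩
  (floor a ℤ.+ 1ℤ) / 1 + 1ℚ       ≡⟨ cong (_+ 1ℚ) (/1-homo-+ (floor a) 1ℤ) ⟩
  floor a / 1 + 1ℚ + 1ℚ           ∎
  where open ≡-Reasoning

InUnitWindow : ℚ → ℚ → Set
InUnitWindow a t = a ≤ t × t ≤ a + 1ℚ

module _ {lo a : ℚ} (lo≤a : lo ≤ a) (a<lo+1 : a < lo + 1ℚ) where
  open ≤-Reasoning

  unitWindow⊆expandedWindow : ∀ {t} → InUnitWindow a t → lo ≤ t × t < lo + 1ℚ + 1ℚ
  unitWindow⊆expandedWindow (a≤t , t≤a+1) = ≤-trans lo≤a a≤t , ≤-<-trans t≤a+1 (+-monoˡ-< 1ℚ a<lo+1)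

  expandedWindow⊆shiftedUnitWindows : ∀ {t} → lo ≤ t → t < lo + 1ℚ + 1ℚ →
    InUnitWindow a t ⊎ InUnitWindow a (t - 1ℚ) ⊎ InUnitWindow a (t + 1ℚ)
  expandedWindow⊆shiftedUnitWindows {t} lo≤t t<lo+2 with t <? a | a + 1ℚ <? t
  ... | yes t<a | _ = inj₂ (inj₂ (a≤t+1 , +-monoˡ-≤ 1ℚ (<⇒≤ t<a)))
    where
    a≤t+1 : a ≤ t + 1ℚ
    a≤t+1 = <⇒≤ (begin-strict a <⟨ a<lo+1 ⟩ lo + 1ℚ ≤⟨ +-monoˡ-≤ 1ℚ lo≤t ⟩ t + 1ℚ ∎)
  ... | no _ | yes a+1<t = inj₂ (inj₁ (a≤t-1 , t-1≤a+1))
    where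
    a≤t-1 : a ≤ t - 1ℚ
    a≤t-1 = begin
      a                 ≡⟨ //-rightDividesʳ +-0-group 1ℚ a ⟨
      a + 1ℚ - 1ℚ       ≤⟨ +-monoˡ-≤ (- 1ℚ) (<⇒≤ a+1<t) ⟩
      t - 1ℚ            ∎
    t-1≤a+1 : t - 1ℚ ≤ a + 1ℚ
    t-1≤a+1 = begin
      t - 1ℚ            ≤⟨ +-monoˡ-≤ (- 1ℚ) (<⇒≤ t<a+2) ⟩
      a + 1ℚ + 1ℚ - 1ℚ  ≡⟨ //-rightDividesʳ +-0-group 1ℚ (a + 1ℚ) ⟩
      a + 1ℚ            ∎
      where
      t<a+2 : t < a + 1ℚ + 1ℚ
      t<a+2 = begin-strict
        t                 <⟨ t<lo+2 ⟩
        lo + 1ℚ + 1ℚ      ≤⟨ +-monoˡ-≤ 1ℚ (+-monoˡ-≤ 1ℚ lo≤a) ⟩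
        a + 1ℚ + 1ℚ       ∎
  ... | no t≮a | no a+1≮t = inj₁ (≮⇒≥ t≮a , ≮⇒≥ a+1≮t)

module _ {A : Set} {P Q : A → Set} (P? : Decidable P) (Q? : Decidable Q) (P⇒Q : ∀ {x} → P x → Q x) where

  length-filter-≥⇒⊇ : ∀ {xs} → length (filter Q? xs) ℕ.≤ length (filter P? xs) →
                      ∀ {x} → x ∈ xs → Q x → P x
  length-filter-≥⇒⊇ {xs} Q≤P x∈xs Qx =
    proj₂ (∈-filter⁻ P? {xs = xs} (subst (_ ∈_) (sym filterP≡filterQ) (∈-filter⁺ Q? x∈xs Qx)))
    where
    filterP⊆filterQ : filter P? xs ⊆ filter Q? xs
    filterP⊆filterQ = filter⁺ P? Q? (λ { refl → P⇒Q }) (⊆-refl {x = xs})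
    filterP≡filterQ : filter P? xs ≡ filter Q? xs
    filterP≡filterQ =
      Pointwise-≡⇒≡ (to-≋ (ℕ.≤-antisym (length-mono-≤ filterP⊆filterQ) Q≤P) filterP⊆filterQ)

module _ (T : Tree) where

  step-shift : ∀ d {s s' : Stop T} → Step T s s' →
               Step T (proj₁ s , proj₂ s + d) (proj₁ s' , proj₂ s' + d)
  step-shift d (inj₁ (u≡v , t≤t')) = inj₁ (u≡v , +-monoˡ-≤ d t≤t')
  step-shift d {_ , t} {_ , t'} (inj₂ (i , edge , t+ℓ≤t')) = inj₂ (i , edge , (begin
    t + d + ℓ    ≡⟨ xy∙z≈xz∙y t d ℓ ⟩
    t + ℓ + d    ≤⟨ +-monoˡ-≤ d t+ℓ≤t' ⟩
    t' + d       ∎))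
    where
    open ≤-Reasoning
    open CommutativeSemigroup (CommutativeMonoid.commutativeSemigroup +-0-commutativeMonoid) using (xy∙z≈xz∙y)
    ℓ = Tree.len T i

  validRun-shift : ∀ d {R} → ValidRun T R → ValidRun T (shift T d R)
  validRun-shift d []             = []
  validRun-shift d [ s ]          = [ _ ]
  validRun-shift d (step ∷ valid) = step-shift d step ∷ validRun-shift d valid

  visitsIn-shift : ∀ d {R v lo hi} → Any (λ s → proj₁ s ≡ v × lo ≤ proj₂ s + d × proj₂ s + d ≤ hi) R →
                   VisitsIn T (shift T d R) v lo hi
  visitsIn-shift d (here visit)  = here visit
  visitsIn-shift d (there visit) = there (visitsIn-shift d visit)

  repairRuns : Run T → List (Run T)
  repairRuns R = R ∷ shift T (- 1ℚ) R ∷ shift T 1ℚ R ∷ []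

  repairRuns-valid : ∀ {R} → ValidRun T R → All (ValidRun T) (repairRuns R)
  repairRuns-valid valid = valid All.∷ validRun-shift (- 1ℚ) valid All.∷ validRun-shift 1ℚ valid All.∷ All.[]

  services⇒servicesExpanded : ∀ {R} r → Services T R r → ServicesExpanded T R r
  services⇒servicesExpanded (v , a) = Any.map λ (at-v , window) →
    at-v , map₂ (subst (_ <_) (sym (expHi≡expLo+2 a)))
                (unitWindow⊆expandedWindow (floor-≤ a) (<-floor+1 a) window)

  expandedVisit⇒shiftedVisit : ∀ {v a} {s : Stop T} → proj₁ s ≡ v × expLo a ≤ proj₂ s × proj₂ s < expHi a →
      (proj₁ s ≡ v × InUnitWindow a (proj₂ s))
    ⊎ (proj₁ s ≡ v × InUnitWindow a (proj₂ s - 1ℚ))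
    ⊎ (proj₁ s ≡ v × InUnitWindow a (proj₂ s + 1ℚ))
  expandedVisit⇒shiftedVisit {a = a} (at-v , lo≤t , t<hi) =
    Sum.map (at-v ,_) (Sum.map (at-v ,_) (at-v ,_))
      (expandedWindow⊆shiftedUnitWindows (floor-≤ a) (<-floor+1 a) lo≤t
                                          (subst (_ <_) (expHi≡expLo+2 a) t<hi))

  servicesExpanded⇒repairRunsService : ∀ {R} r → ServicesExpanded T R r →
                                       Any (λ R' → Services T R' r) (repairRuns R)
  servicesExpanded⇒repairRunsService r visit with Any-⊎⁻ (Any.map expandedVisit⇒shiftedVisit visit)
  ... | inj₁ on-time = here on-time
  ... | inj₂ shifted with Any-⊎⁻ shifted
  ...   | inj₁ too-late  = there (here (visitsIn-shift (- 1ℚ) too-late))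
  ...   | inj₂ too-early = there (there (here (visitsIn-shift 1ℚ too-early)))

  maxExpanded-servicesClass : ∀ {m} (reqs : Fin m → Request T) {C : ℚ → Set} (C? : ∀ a → Dec (C a))
                              {R R*} →
    MaxExpanded T reqs C? R → ValidRun T R* → (∀ i → ServicesExpanded T R* (reqs i)) →
    ∀ i → C (proj₂ (reqs i)) → ServicesExpanded T R (reqs i)
  maxExpanded-servicesClass reqs {C} C? {R} {R*} (_ , maximal) R*-valid R*-services i Ci =
    proj₂ (length-filter-≥⇒⊇ (servicedBy R) (servicedBy R*) (λ (Cj , _) → Cj , R*-services _)
                             (maximal R* R*-valid) (∈-allFin i) (Ci , R*-services i))
    where
    servicedBy : ∀ R' j → Dec (C (proj₂ (reqs j)) × ServicesExpanded T R' (reqs j))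
    servicedBy R' j = C? (proj₂ (reqs j)) ×-dec servicesExpanded? T R' (reqs j)

mainTheorem2 : (T : Tree) (m : ℕ) (reqs : Fin m → Request T) →
    ((i : Fin m) → 0ℚ ≤ proj₂ (reqs i)) →
    ((i : Fin m) (k : ℤ) → proj₂ (reqs i) ≢ k / 1) →
    (Σ (Run T) λ R → ValidRun T R × ((i : Fin m) → Services T R (reqs i))) →
    (RE RO : Run T) →
    MaxExpanded T reqs inE? RE →
    MaxExpanded T reqs inO? RO →
    All (ValidRun T)
        (RE ∷ shift T (- 1ℚ) RE ∷ shift T 1ℚ RE ∷ RO ∷ shift T (- 1ℚ) RO ∷ shift T 1ℚ RO ∷ [])
    × ((i : Fin m) → Any (λ R → Services T R (reqs i))
        (RE ∷ shift T (- 1ℚ) RE ∷ shift T 1ℚ RE ∷ RO ∷ shift T (- 1ℚ) RO ∷ shift T 1ℚ RO ∷ []))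
mainTheorem2 T m reqs _ _ (R* , R*-valid , R*-services) RE RO RE-max RO-max =
  All.++⁺ (repairRuns-valid T (proj₁ RE-max)) (repairRuns-valid T (proj₁ RO-max)) , serviced
  where
  R*-servicesExpanded : ∀ i → ServicesExpanded T R* (reqs i)
  R*-servicesExpanded i = services⇒servicesExpanded T (reqs i) (R*-services i)

  serviced : ∀ i → Any (λ R → Services T R (reqs i)) (repairRuns T RE ++ repairRuns T RO)
  serviced i with inE? (proj₂ (reqs i))
  ... | yes even = ++⁺ˡ (servicesExpanded⇒repairRunsService T (reqs i)
                          (maxExpanded-servicesClass T reqs inE? RE-max R*-valid R*-servicesExpanded i even))
  ... | no odd   = ++⁺ʳ (repairRuns T RE) (servicesExpanded⇒repairRunsService T (reqs i)
                          (maxExpanded-servicesClass T reqs inO? RO-max R*-valid R*-servicesExpanded i odd))
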